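{- Let $c,c'$ be GCL commands and $f,f'$ labels with $\mathrm{okf}(c,f)$ and $\mathrm{okf}(c',f')$. Let $L,R,J$ be live alignment conditions for $\mathrm{aut}(c,f),\mathrm{aut}(c',f')$, and let $an$ be a valid annotation of the alignment automaton $\prod(\mathrm{aut}(c,f),\mathrm{aut}(c',f'),L,R,J)$ for $\{\mathcal{S}\}\{\mathcal{T}\}$ such that $\breve{an}(i,j)\subseteq L\cup R\cup J\cup[f|f']$ for every control point $(i,j)$ of the product. Then the judgment $c\mid c':\langle\mathcal{S}\Rightarrow\mathcal{T}\rangle$ has a proof in RHL+.
   Context: Stores: total functions $\mathit{Var}\to\mathbb{Z}$. GCL commands $c::=\mathsf{skip}^n\mid x:=^n e\mid\mathsf{havoc}^n x\mid c;c\mid\mathsf{if}^n gcs\,\mathsf{fi}\mid\mathsf{do}^n gcs\,\mathsf{od}$, labels $n\in\mathbb{Z}$, $gcs$ nonempty lists of guarded commands $e\to c$, guards built from primitive boolean expressions $bprim$ by $\wedge,\vee,\neg$, $\mathrm{enab}(gcs)$ the disjunction of guards; commands well typed with each $\mathsf{if}\,gcs\,\mathsf{fi}$ having $\mathrm{enab}(gcs)$ valid. $\mathrm{labs}(c)$: labels of $c$; $\mathrm{lab}(c)$: label of $c$, $\mathrm{lab}(c;d)=\mathrm{lab}(c)$; $\mathrm{okf}(c,f)$: labels of $c$ positive, pairwise distinct, $f\notin\mathrm{labs}(c)$; $\mathrm{sub}(n,c)$: subcommand of $c$ not of the form $d;d'$ with label $n$. Small-step semantics: $\langle\mathsf{havoc}^n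 x,s\rangle\rightsquigarrow\langle\mathsf{skip}^{ -n},s[x\mapsto v]\rangle$; $\langle x:=^n e,s\rangle\rightsquigarrow\langle\mathsf{skip}^{ -n},s[x\mapsto\llbracket e\rrbracket(s)]\rangle$; $\langle\mathsf{skip}^n;c,s\rangle\rightsquigarrow\langle c,s\rangle$; $\langle\mathsf{if}^n gcs\,\mathsf{fi},s\rangle\rightsquigarrow\langle c,s\rangle$ for $e\to c\in gcs$ with $e$ true in $s$; $\langle\mathsf{do}^n gcs\,\mathsf{od},s\rangle\rightsquigarrow\langle c;\mathsf{do}^n gcs\,\mathsf{od},s\rangle$ for $e\to c\in gcs$ with $e$ true; $\langle\mathsf{do}^n gcs\,\mathsf{od},s\rangle\rightsquigarrow\langle\mathsf{skip}^{ -n},s\rangle$ if $\mathrm{enab}(gcs)$ false; $\langle c;b,s\rangle\rightsquigarrow\langle d;b,t\rangle$ if $\langle c,s\rangle\rightsquigarrow\langle d,t\rangle$. $\mathrm{fsuc}(n,c;d,f)=\mathrm{fsuc}(n,c,\mathrm{lab}(d))$ if $n\in\mathrm{labs}(c)$, else $\mathrm{fsuc}(n,d,f)$; $\mathrm{fsuc}(n,c,f)=f$ when $c$ is an if, do, skip, assignment or havoc with label $n$; $\mathrm{fsuc}(m,\mathsf{if}^n gcs\,\mathsf{fi},f)=\mathrm{fsuc}(m,c,f)$ and $\mathrm{fsuc}(m,\mathsf{do}^n gcs\,\mathsf{od},f)=\mathrm{fsuc}(m,c,n)$ for $e\to c\in gcs$, $m\in\mathrm{labs}(c)$. $\mathrm{aut}(c,f)$: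 control points $\mathrm{labs}(c)\cup\{f\}$, stores $\mathit{Var}\to\mathbb{Z}$, initial $\mathrm{lab}(c)$, final $f$, $(n,s)\to(m,t)$ iff (i) $\langle\mathrm{sub}(n,c),s\rangle\rightsquigarrow\langle d,t\rangle$, $\mathrm{lab}(d)>0$, $m=\mathrm{lab}(d)$; or (ii) $\langle\mathrm{sub}(n,c),s\rangle\rightsquigarrow\langle d,t\rangle$, $\mathrm{lab}(d)<0$, $m=\mathrm{fsuc}(n,c,f)$; or (iii) $\mathrm{sub}(n,c)=\mathsf{skip}^n$, $m=\mathrm{fsuc}(n,c,f)$, $t=s$. For automata $A$ (transitions $\to$) and $A'$ (transitions $\to'$) with control sets $Ctrl,Ctrl'$ and stores $Sto,Sto'$: $L,R,J\subseteq(Ctrl\times Ctrl')\times(Sto\times Sto')$ are live if states in $L$ have a left successor, in $R$ a right successor, in $J$ both; $\prod(A,A',L,R,J)$ has control points $Ctrl\times Ctrl'$, stores $Sto\times Sto'$, initial/final pairs of initial/final controls, and $((n,n'),(s,s'))\Rightarrow((m,m'),(t,t'))$ iff (LO) source in $L$, $(n,s)\to(m,t)$, $(n',s')=(m',t')$; (RO) source in $R$, $(n,s)=(m,t)$, $(n',s')\to'(m',t')$; or (JO) source in $J$, both step. An annotation of the product for $\{\mathcal{S}\}\{\mathcal{T}\}$ is a map $an$ from product control points to store relations with $an(\mathrm{lab}(c),\mathrm{lab}(c'))=\mathcal{S}$, $an(f,f')=\mathcal{T}$; valid if $(s,s')\in an(n,n')$ and $((n,n'),(s,s'))\Rightarrow((m,m'),(t,t'))$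 imply $(t,t')\in an(m,m')$. $\breve{an}(n,n')=\{((n,n'),(s,s'))\mid(s,s')\in an(n,n')\}$; $[f|f']$ is the set of product states with control $(f,f')$. RHL+: relations as in the following. $\langle P]=\{(s,s')\mid s\in P\}$, $[P\rangle=\{(s,s')\mid s'\in P\}$, a boolean expression denoting the stores where it is true; $\langle e|=|e'\rangle=\{(s,s')\mid\llbracket e\rrbracket(s)=\llbracket e'\rrbracket(s')\}$; $\mathcal{R}[x|:=e|]=\{(s,s')\mid(s[x\mapsto\llbracket e\rrbracket(s)],s')\in\mathcal{R}\}$, $\mathcal{R}[|x:=|e]$ symmetric; $(\forall x|.\mathcal{P})=\{(s,s')\mid\forall v.(s[x\mapsto v],s')\in\mathcal{P}\}$, $(\forall|x.\mathcal{P})$ symmetric; $\mathrm{indep}(x|x',\mathcal{R})$: $\mathcal{R}=\{(s,s')\mid\exists v,v'.(s[x\mapsto v],s'[x'\mapsto v'])\in\mathcal{R}\}$; $\mathrm{ghost}(x,c)$: $x$ occurs in $c$ only as target of assignments to $x$ and of $\mathsf{havoc}\,x$; $\mathrm{erase}(x,c)$ replaces these by $\mathsf{skip}$. $c\simeq d$ means $\mathrm{Hyp}\vdash\lfloor c\rfloor=\lfloor d\rfloor$ where $\lfloor\cdot\rfloor$ translates to KAT expressions ($\lfloor\mathsf{skip}\rfloor=1$; assignments, havocs, primitive boolean expressions to primitive symbols; $\wedge,\vee,\neg$ to $;,+,\neg$; $\lfloor c;d\rfloor=\lfloor c\rfloor;\lfloor d\rfloor$; $\lfloor\mathsf{if}\,gcs\,\mathsf{fi}\rfloor=\lfloor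 gcs\rfloor=\sum_{e\to c\in gcs}\lfloor e\rfloor;\lfloor c\rfloor$; $\lfloor\mathsf{do}\,gcs\,\mathsf{od}\rfloor=\lfloor gcs\rfloor^*;\neg\lfloor\mathrm{enab}(gcs)\rfloor$), $\vdash$ is equational and propositional reasoning from the KAT axioms (idempotent semiring, Boolean algebra of tests, $1+x;x^*=x^*$, $1+x^*;x=x^*$, $y+x;z\le z\Rightarrow x^*;y\le z$, $y+z;x\le z\Rightarrow y;x^*\le z$), and $\mathrm{Hyp}$ = \{$\lfloor e\rfloor=0$ for unsatisfiable $e$; $\lfloor e_0\rfloor;\lfloor x:=e\rfloor;\neg\lfloor e_1\rfloor=0$ when $e_0\Rightarrow e_1[x:=e]$ valid; $\lfloor e_0\rfloor;\lfloor\mathsf{havoc}\,x\rfloor;\neg\lfloor e_1\rfloor=0$ when $e_0\Rightarrow\forall x.e_1$ valid\}. The rules of RHL+ are: rGhost (from $c\mid c':\langle\mathcal{R}\Rightarrow\mathcal{S}\rangle$, $\mathrm{ghost}(x,c)$, $\mathrm{ghost}(x',c')$, $\mathrm{indep}(x|x',\mathcal{R})$, $\mathrm{indep}(x|x',\mathcal{S})$ infer $\mathrm{erase}(x,c)\mid\mathrm{erase}(x',c'):\langle\mathcal{R}\Rightarrow\mathcal{S}\rangle$); rRewrite (from $c\mid c':\langle\mathcal{R}\Rightarrow\mathcal{S}\rangle$, $c\simeq d$, $c'\simeq d'$ infer $d\mid d':\langle\mathcal{R}\Rightarrow\mathcal{S}\rangle$); rSkip $\mathsf{skip}\mid\mathsf{skip}:\langle\mathcal{R}\Rightarrow\mathcal{R}\rangle$;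 rAsgnSkip $x:=e\mid\mathsf{skip}:\langle\mathcal{R}[x|:=e|]\Rightarrow\mathcal{R}\rangle$; rSkipAsgn $\mathsf{skip}\mid x:=e:\langle\mathcal{R}[|x:=|e]\Rightarrow\mathcal{R}\rangle$; rHavSkip $\mathsf{havoc}\,x\mid\mathsf{skip}:\langle(\forall x|.\mathcal{P})\Rightarrow\mathcal{P}\rangle$; rSkipHav $\mathsf{skip}\mid\mathsf{havoc}\,x:\langle(\forall|x.\mathcal{P})\Rightarrow\mathcal{P}\rangle$; rSeq (from $c\mid c':\langle\mathcal{R}\Rightarrow\mathcal{S}\rangle$, $d\mid d':\langle\mathcal{S}\Rightarrow\mathcal{T}\rangle$ infer $c;d\mid c';d':\langle\mathcal{R}\Rightarrow\mathcal{T}\rangle$); rIf (from $c\mid c':\langle\mathcal{R}\wedge\langle e]\wedge[e'\rangle\Rightarrow\mathcal{S}\rangle$ for all $e\to c\in gcs$, $e'\to c'\in gcs'$ infer $\mathsf{if}\,gcs\,\mathsf{fi}\mid\mathsf{if}\,gcs'\,\mathsf{fi}:\langle\mathcal{R}\Rightarrow\mathcal{S}\rangle$); rDo (for relations $\mathcal{Q},\mathcal{L},\mathcal{R}$: from $c\mid\mathsf{skip}:\langle\mathcal{Q}\wedge\langle e]\wedge\mathcal{L}\Rightarrow\mathcal{Q}\rangle$ for all $e\to c\in gcs$, $\mathsf{skip}\mid c':\langle\mathcal{Q}\wedge[e'\rangle\wedge\mathcal{R}\Rightarrow\mathcal{Q}\rangle$ for all $e'\to c'\in gcs'$, $c\mid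 c':\langle\mathcal{Q}\wedge\langle e]\wedge[e'\rangle\wedge\neg\mathcal{L}\wedge\neg\mathcal{R}\Rightarrow\mathcal{Q}\rangle$ for all such pairs, and $\mathcal{Q}\Rightarrow(\langle\mathrm{enab}(gcs)|=|\mathrm{enab}(gcs')\rangle\vee(\mathcal{L}\wedge\langle\mathrm{enab}(gcs)])\vee(\mathcal{R}\wedge[\mathrm{enab}(gcs')\rangle))$, infer $\mathsf{do}\,gcs\,\mathsf{od}\mid\mathsf{do}\,gcs'\,\mathsf{od}:\langle\mathcal{Q}\Rightarrow\mathcal{Q}\wedge\neg\langle\mathrm{enab}(gcs)]\wedge\neg[\mathrm{enab}(gcs')\rangle\rangle$); rConseq (from $\mathcal{P}\Rightarrow\mathcal{R}$, $c\mid d:\langle\mathcal{R}\Rightarrow\mathcal{S}\rangle$, $\mathcal{S}\Rightarrow\mathcal{Q}$ infer $c\mid d:\langle\mathcal{P}\Rightarrow\mathcal{Q}\rangle$); rDisj (from $c\mid d:\langle\mathcal{Q}\Rightarrow\mathcal{S}\rangle$ and $c\mid d:\langle\mathcal{R}\Rightarrow\mathcal{S}\rangle$ infer $c\mid d:\langle\mathcal{Q}\vee\mathcal{R}\Rightarrow\mathcal{S}\rangle$); rFalse $c\mid d:\langle\mathit{false}\Rightarrow\mathcal{R}\rangle$. Entailments between relations (e.g., in rConseq) are taken as semantic inclusions. -}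

module Defs where

open import Data.Nat as ℕ using (ℕ)
open import Data.Integer as ℤ using (ℤ; +_; -_; _<_)
open import Data.Integer.Properties as ℤP using ()
open import Data.Bool as B using (Bool; true; false; if_then_else_)
open import Data.List using (List; []; _∷_; _++_)
open import Data.List.Membership.Propositional using (_∈_; _∉_)
open import Data.List.Relation.Unary.All using (All)
open import Data.List.Relation.Unary.Unique.Propositional using (Unique)
open import Data.Product using (Σ; _×_; _,_)
open import Data.Sum using (_⊎_)
open import Data.Unit using (⊤)
open import Data.Empty using (⊥)
open import Relation.Nullary using (¬_; does)
open import Relation.Binary.PropositionalEquality using (_≡_)

Var : Set
Var = ℕ

Store : Set
Store = Var → ℤ

upd : Store → Var → ℤ → Store
upd s x v y = if y ℕ.≡ᵇ x then v else s y

data IExp : Set where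
  var : Var → IExp
  lit : ℤ → IExp
  add sub mul : IExp → IExp → IExp

evalI : IExp → Store → ℤ
evalI (var x) s = s x
evalI (lit z) s = z
evalI (add a b) s = evalI a s ℤ.+ evalI b s
evalI (sub a b) s = evalI a s ℤ.- evalI b s
evalI (mul a b) s = evalI a s ℤ.* evalI b s

data BPrim : Set where
  eqP ltP leP : IExp → IExp → BPrim

evalP : BPrim → Store → Bool
evalP (eqP a b) s = does (evalI a s ℤP.≟ evalI b s)
evalP (ltP a b) s = does (evalI a s ℤP.<? evalI b s)
evalP (leP a b) s = does (evalI a s ℤP.≤? evalI b s)

data BExp : Set where
  prim : BPrim → BExp
  andB orB : BExp → BExp → BExp
  notB : BExp → BExp

evalB : BExp → Store → Bool
evalB (prim p) s = evalP p s
evalB (andB a b) s = evalB a s B.∧ evalB b s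
evalB (orB a b) s = evalB a s B.∨ evalB b s
evalB (notB a) s = B.not (evalB a s)

mutual
  data Cmd : Set where
    skip  : ℤ → Cmd
    asgn  : ℤ → Var → IExp → Cmd
    havoc : ℤ → Var → Cmd
    _⨾_   : Cmd → Cmd → Cmd
    ifc   : ℤ → GCs → Cmd
    doc   : ℤ → GCs → Cmd

  data GCs : Set where
    [_⇒_]   : BExp → Cmd → GCs
    _⇒_∷_   : BExp → Cmd → GCs → GCs

infixr 5 _⨾_

data InG (e : BExp) (c : Cmd) : GCs → Set where
  here1 : InG e c [ e ⇒ c ]
  hereC : ∀ {g} → InG e c (e ⇒ c ∷ g)
  there : ∀ {e' c' g} → InG e c g → InG e c (e' ⇒ c' ∷ g)

enab : GCs → BExp
enab [ e ⇒ c ] = e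
enab (e ⇒ c ∷ g) = orB e (enab g)

ValidB : BExp → Set
ValidB e = ∀ s → evalB e s ≡ true

mutual
  WF : Cmd → Set
  WF (skip n) = ⊤
  WF (asgn n x e) = ⊤
  WF (havoc n x) = ⊤
  WF (c ⨾ d) = WF c × WF d
  WF (ifc n g) = ValidB (enab g) × WFG g
  WF (doc n g) = WFG g

  WFG : GCs → Set
  WFG [ e ⇒ c ] = WF c
  WFG (e ⇒ c ∷ g) = WF c × WFG g

lab : Cmd → ℤ
lab (skip n) = n
lab (asgn n x e) = n
lab (havoc n x) = n
lab (c ⨾ d) = lab c
lab (ifc n g) = n
lab (doc n g) = n

mutual
  labs : Cmd → List ℤ
  labs (skip n) = n ∷ []
  labs (asgn n x e) = n ∷ []
  labs (havoc n x) = n ∷ []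
  labs (c ⨾ d) = labs c ++ labs d
  labs (ifc n g) = n ∷ labsG g
  labs (doc n g) = n ∷ labsG g

  labsG : GCs → List ℤ
  labsG [ e ⇒ c ] = labs c
  labsG (e ⇒ c ∷ g) = labs c ++ labsG g

okf : Cmd → ℤ → Set
okf c f = All (λ n → + 0 < n) (labs c) × Unique (labs c) × f ∉ labs c

data SubC : Cmd → Cmd → Set where
  refl   : ∀ {c} → SubC c c
  seqL   : ∀ {c c' d} → SubC c d → SubC (c ⨾ c') d
  seqR   : ∀ {c c' d} → SubC c' d → SubC (c ⨾ c') d
  inIf   : ∀ {n g e c d} → InG e c g → SubC c d → SubC (ifc n g) d
  inDo   : ∀ {n g e c d} → InG e c g → SubC c d → SubC (doc n g) d

NotSeq : Cmd → Set
NotSeq (c ⨾ d) = ⊥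
NotSeq _ = ⊤

Sub : ℤ → Cmd → Cmd → Set
Sub n c d = SubC c d × NotSeq d × lab d ≡ n

memb : ℤ → List ℤ → Bool
memb n [] = false
memb n (m ∷ ms) = does (n ℤP.≟ m) B.∨ memb n ms

-- fsuc(n,c,f) (with an arbitrary default where the paper leaves it undefined)
mutual
  fsuc : ℤ → Cmd → ℤ → ℤ
  fsuc n (c ⨾ d) f = if memb n (labs c) then fsuc n c (lab d) else fsuc n d f
  fsuc n (skip m) f = f
  fsuc n (asgn m x e) f = f
  fsuc n (havoc m x) f = f
  fsuc n (ifc m g) f = if does (n ℤP.≟ m) then f else fsucG n g f
  fsuc n (doc m g) f = if does (n ℤP.≟ m) then f else fsucG n g m

  fsucG : ℤ → GCs → ℤ → ℤ
  fsucG n [ e ⇒ c ] f = fsuc n c f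
  fsucG n (e ⇒ c ∷ g) f = if memb n (labs c) then fsuc n c f else fsucG n g f

data Step : Cmd → Store → Cmd → Store → Set where
  sHavoc  : ∀ {n x s} (v : ℤ) → Step (havoc n x) s (skip (- n)) (upd s x v)
  sAsgn   : ∀ {n x e s} → Step (asgn n x e) s (skip (- n)) (upd s x (evalI e s))
  sSkip   : ∀ {n c s} → Step (skip n ⨾ c) s c s
  sIf     : ∀ {n g e c s} → InG e c g → evalB e s ≡ true → Step (ifc n g) s c s
  sDo     : ∀ {n g e c s} → InG e c g → evalB e s ≡ true
            → Step (doc n g) s (c ⨾ doc n g) s
  sDoExit : ∀ {n g s} → evalB (enab g) s ≡ false → Step (doc n g) s (skip (- n)) s
  sSeq    : ∀ {c b d s t} → Step c s d t → Step (c ⨾ b) s (d ⨾ b) t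

Ctrl : Cmd → ℤ → ℤ → Set
Ctrl c f n = n ∈ labs c ⊎ n ≡ f

AutStep : Cmd → ℤ → ℤ → Store → ℤ → Store → Set
AutStep c f n s m t =
    (Σ Cmd λ d0 → Σ Cmd λ d → Sub n c d0 × Step d0 s d t × + 0 < lab d × m ≡ lab d)
  ⊎ (Σ Cmd λ d0 → Σ Cmd λ d → Sub n c d0 × Step d0 s d t × lab d < + 0 × m ≡ fsuc n c f)
  ⊎ (Sub n c (skip n) × m ≡ fsuc n c f × t ≡ s)

PState : Set
PState = (ℤ × ℤ) × (Store × Store)

PSet : Set₁
PSet = PState → Set

InCtrl : Cmd → ℤ → Cmd → ℤ → PSet → Set
InCtrl c f c' f' X = ∀ n n' s s' → X ((n , n') , (s , s')) → Ctrl c f n × Ctrl c' f' n'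

Live : Cmd → ℤ → Cmd → ℤ → PSet → PSet → PSet → Set
Live c f c' f' L R J =
    (∀ n n' s s' → L ((n , n') , (s , s')) → LeftS n s)
  × (∀ n n' s s' → R ((n , n') , (s , s')) → RightS n' s')
  × (∀ n n' s s' → J ((n , n') , (s , s')) → LeftS n s × RightS n' s')
  where
  LeftS : ℤ → Store → Set
  LeftS n s = Σ ℤ λ m → Σ Store λ t → AutStep c f n s m t
  RightS : ℤ → Store → Set
  RightS n' s' = Σ ℤ λ m' → Σ Store λ t' → AutStep c' f' n' s' m' t'

PStep : Cmd → ℤ → Cmd → ℤ → PSet → PSet → PSet → PState → PState → Set
PStep c f c' f' L R J ((n , n') , (s , s')) ((m , m') , (t , t')) =
    (L ((n , n') , (s , s')) × AutStep c f n s m t × n' ≡ m' × s' ≡ t')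
  ⊎ (R ((n , n') , (s , s')) × n ≡ m × s ≡ t × AutStep c' f' n' s' m' t')
  ⊎ (J ((n , n') , (s , s')) × AutStep c f n s m t × AutStep c' f' n' s' m' t')

Rel : Set₁
Rel = Store → Store → Set

_⇒R_ : Rel → Rel → Set
P ⇒R Q = ∀ s s' → P s s' → Q s s'

_≐_ : Rel → Rel → Set
P ≐ Q = (P ⇒R Q) × (Q ⇒R P)

_∧R_ _∨R_ : Rel → Rel → Rel
(P ∧R Q) s s' = P s s' × Q s s'
(P ∨R Q) s s' = P s s' ⊎ Q s s'

¬R : Rel → Rel
¬R P s s' = ¬ P s s'

falseR : Rel
falseR s s' = ⊥

infixr 6 _∧R_
infixr 5 _∨R_

⟨_] : BExp → Rel
⟨ e ] s s' = evalB e s ≡ true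

[_⟩ : BExp → Rel
[ e ⟩ s s' = evalB e s' ≡ true

⟨_∣=∣_⟩ : BExp → BExp → Rel
⟨ e ∣=∣ e' ⟩ s s' = evalB e s ≡ evalB e' s'

substL : Rel → Var → IExp → Rel
substL P x e s s' = P (upd s x (evalI e s)) s'

substR : Rel → Var → IExp → Rel
substR P x e s s' = P s (upd s' x (evalI e s'))

allL : Var → Rel → Rel
allL x P s s' = ∀ v → P (upd s x v) s'

allR : Var → Rel → Rel
allR x P s s' = ∀ v → P s (upd s' x v)

indep : Var → Var → Rel → Set
indep x x' P = P ≐ (λ s s' → Σ ℤ λ v → Σ ℤ λ v' → P (upd s x v) (upd s' x' v'))

occI : Var → IExp → Bool
occI x (var y) = y ℕ.≡ᵇ x
occI x (lit z) = false
occI x (add a b) = occI x a B.∨ occI x b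
occI x (sub a b) = occI x a B.∨ occI x b
occI x (mul a b) = occI x a B.∨ occI x b

occP : Var → BPrim → Bool
occP x (eqP a b) = occI x a B.∨ occI x b
occP x (ltP a b) = occI x a B.∨ occI x b
occP x (leP a b) = occI x a B.∨ occI x b

occB : Var → BExp → Bool
occB x (prim p) = occP x p
occB x (andB a b) = occB x a B.∨ occB x b
occB x (orB a b) = occB x a B.∨ occB x b
occB x (notB a) = occB x a

mutual
  occC : Var → Cmd → Bool
  occC x (skip n) = false
  occC x (asgn n y e) = occI x e
  occC x (havoc n y) = false
  occC x (c ⨾ d) = occC x c B.∨ occC x d
  occC x (ifc n g) = occG x g
  occC x (doc n g) = occG x g

  occG : Var → GCs → Bool
  occG x [ e ⇒ c ] = occB x e B.∨ occC x c
  occG x (e ⇒ c ∷ g) = occB x e B.∨ occC x c B.∨ occG x g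

ghost : Var → Cmd → Set
ghost x c = occC x c ≡ false

mutual
  erase : Var → Cmd → Cmd
  erase x (skip n) = skip n
  erase x (asgn n y e) = if y ℕ.≡ᵇ x then skip n else asgn n y e
  erase x (havoc n y) = if y ℕ.≡ᵇ x then skip n else havoc n y
  erase x (c ⨾ d) = erase x c ⨾ erase x d
  erase x (ifc n g) = ifc n (eraseG x g)
  erase x (doc n g) = doc n (eraseG x g)

  eraseG : Var → GCs → GCs
  eraseG x [ e ⇒ c ] = [ e ⇒ erase x c ]
  eraseG x (e ⇒ c ∷ g) = e ⇒ erase x c ∷ eraseG x g

data Action : Set where
  aAsgn : Var → IExp → Action
  aHav  : Var → Action

data Test : Set where
  tprim : BPrim → Test
  tzero tone : Test
  tand tor : Test → Test → Test
  tnot : Test → Test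

data KExp : Set where
  tst  : Test → KExp
  act  : Action → KExp
  _⊕_  : KExp → KExp → KExp
  _⊙_  : KExp → KExp → KExp
  _⋆   : KExp → KExp

infixl 6 _⊕_
infixl 7 _⊙_
infix 8 _⋆

𝟘 𝟙 : KExp
𝟘 = tst tzero
𝟙 = tst tone

⌊_⌋B : BExp → Test
⌊ prim p ⌋B = tprim p
⌊ andB a b ⌋B = tand ⌊ a ⌋B ⌊ b ⌋B
⌊ orB a b ⌋B = tor ⌊ a ⌋B ⌊ b ⌋B
⌊ notB a ⌋B = tnot ⌊ a ⌋B

mutual
  ⌊_⌋ : Cmd → KExp
  ⌊ skip n ⌋ = 𝟙
  ⌊ asgn n x e ⌋ = act (aAsgn x e)
  ⌊ havoc n x ⌋ = act (aHav x)
  ⌊ c ⨾ d ⌋ = ⌊ c ⌋ ⊙ ⌊ d ⌋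
  ⌊ ifc n g ⌋ = ⌊ g ⌋G
  ⌊ doc n g ⌋ = (⌊ g ⌋G ⋆) ⊙ tst (tnot ⌊ enab g ⌋B)

  ⌊_⌋G : GCs → KExp
  ⌊ [ e ⇒ c ] ⌋G = tst ⌊ e ⌋B ⊙ ⌊ c ⌋
  ⌊ e ⇒ c ∷ g ⌋G = tst ⌊ e ⌋B ⊙ ⌊ c ⌋ ⊕ ⌊ g ⌋G

mutual
  _≤K_ : KExp → KExp → Set
  p ≤K q = KEq (p ⊕ q) q

  data KEq : KExp → KExp → Set where
    krefl  : ∀ {p} → KEq p p
    ksym   : ∀ {p q} → KEq p q → KEq q p
    ktrans : ∀ {p q r} → KEq p q → KEq q r → KEq p r
    k⊕cong : ∀ {p p' q q'} → KEq p p' → KEq q q' → KEq (p ⊕ q) (p' ⊕ q')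
    k⊙cong : ∀ {p p' q q'} → KEq p p' → KEq q q' → KEq (p ⊙ q) (p' ⊙ q')
    k⋆cong : ∀ {p p'} → KEq p p' → KEq (p ⋆) (p' ⋆)
    ⊕assoc : ∀ {p q r} → KEq ((p ⊕ q) ⊕ r) (p ⊕ (q ⊕ r))
    ⊕comm  : ∀ {p q} → KEq (p ⊕ q) (q ⊕ p)
    ⊕idem  : ∀ {p} → KEq (p ⊕ p) p
    ⊕zero  : ∀ {p} → KEq (p ⊕ 𝟘) p
    ⊙assoc : ∀ {p q r} → KEq ((p ⊙ q) ⊙ r) (p ⊙ (q ⊙ r))
    ⊙oneˡ  : ∀ {p} → KEq (𝟙 ⊙ p) p
    ⊙oneʳ  : ∀ {p} → KEq (p ⊙ 𝟙) p
    ⊙zeroˡ : ∀ {p} → KEq (𝟘 ⊙ p) 𝟘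
    ⊙zeroʳ : ∀ {p} → KEq (p ⊙ 𝟘) 𝟘
    distˡ  : ∀ {p q r} → KEq (p ⊙ (q ⊕ r)) (p ⊙ q ⊕ p ⊙ r)
    distʳ  : ∀ {p q r} → KEq ((p ⊕ q) ⊙ r) (p ⊙ r ⊕ q ⊙ r)
    tandE  : ∀ {a b} → KEq (tst (tand a b)) (tst a ⊙ tst b)
    torE   : ∀ {a b} → KEq (tst (tor a b)) (tst a ⊕ tst b)
    tcomm  : ∀ {a b} → KEq (tst a ⊙ tst b) (tst b ⊙ tst a)
    tidem  : ∀ {a} → KEq (tst a ⊙ tst a) (tst a)
    ttop   : ∀ {a} → KEq (tst a ⊕ 𝟙) 𝟙
    tcomplM : ∀ {a} → KEq (tst a ⊙ tst (tnot a)) 𝟘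
    tcomplJ : ∀ {a} → KEq (tst a ⊕ tst (tnot a)) 𝟙
    unfoldˡ : ∀ {p} → KEq (𝟙 ⊕ p ⊙ (p ⋆)) (p ⋆)
    unfoldʳ : ∀ {p} → KEq (𝟙 ⊕ (p ⋆) ⊙ p) (p ⋆)
    indˡ    : ∀ {x y z} → (y ⊕ x ⊙ z) ≤K z → ((x ⋆) ⊙ y) ≤K z
    indʳ    : ∀ {x y z} → (y ⊕ z ⊙ x) ≤K z → (y ⊙ (x ⋆)) ≤K z
    hypUnsat : ∀ {e} → (∀ s → evalB e s ≡ false) → KEq (tst ⌊ e ⌋B) 𝟘
    hypAsgn  : ∀ {e0 e1 x e} → (∀ s → evalB e0 s ≡ true → evalB e1 (upd s x (evalI e s)) ≡ true)
               → KEq (tst ⌊ e0 ⌋B ⊙ act (aAsgn x e) ⊙ tst (tnot ⌊ e1 ⌋B)) 𝟘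
    hypHav   : ∀ {e0 e1 x} → (∀ s → evalB e0 s ≡ true → ∀ v → evalB e1 (upd s x v) ≡ true)
               → KEq (tst ⌊ e0 ⌋B ⊙ act (aHav x) ⊙ tst (tnot ⌊ e1 ⌋B)) 𝟘

_≃_ : Cmd → Cmd → Set
c ≃ d = KEq ⌊ c ⌋ ⌊ d ⌋

data RHL : Cmd → Cmd → Rel → Rel → Set₁ where
  rGhost    : ∀ {c c' R S} x x' → RHL c c' R S → ghost x c → ghost x' c'
              → indep x x' R → indep x x' S → RHL (erase x c) (erase x' c') R S
  rRewrite  : ∀ {c c' d d' R S} → RHL c c' R S → WF c → WF c' → c ≃ d → c' ≃ d'
              → RHL d d' R S
  rSkip     : ∀ {n n' R} → RHL (skip n) (skip n') R R
  rAsgnSkip : ∀ {n n' x e R} → RHL (asgn n x e) (skip n') (substL R x e) R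
  rSkipAsgn : ∀ {n n' x e R} → RHL (skip n) (asgn n' x e) (substR R x e) R
  rHavSkip  : ∀ {n n' x P} → RHL (havoc n x) (skip n') (allL x P) P
  rSkipHav  : ∀ {n n' x P} → RHL (skip n) (havoc n' x) (allR x P) P
  rSeq      : ∀ {c c' d d' R S T} → RHL c c' R S → RHL d d' S T → RHL (c ⨾ d) (c' ⨾ d') R T
  rIf       : ∀ {n n' g g' R S}
              → (∀ e c e' c' → InG e c g → InG e' c' g' → RHL c c' (R ∧R ⟨ e ] ∧R [ e' ⟩) S)
              → RHL (ifc n g) (ifc n' g') R S
  rDo       : ∀ {n n' g g' k k'} (Q L R : Rel)
              → (∀ e c → InG e c g → RHL c (skip k') (Q ∧R ⟨ e ] ∧R L) Q)
              → (∀ e' c' → InG e' c' g' → RHL (skip k) c' (Q ∧R [ e' ⟩ ∧R R) Q)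
              → (∀ e c e' c' → InG e c g → InG e' c' g'
                  → RHL c c' (Q ∧R ⟨ e ] ∧R [ e' ⟩ ∧R ¬R L ∧R ¬R R) Q)
              → Q ⇒R (⟨ enab g ∣=∣ enab g' ⟩ ∨R (L ∧R ⟨ enab g ]) ∨R (R ∧R [ enab g' ⟩))
              → RHL (doc n g) (doc n' g') Q (Q ∧R ¬R ⟨ enab g ] ∧R ¬R [ enab g' ⟩)
  rConseq   : ∀ {c d P Q R S} → P ⇒R R → RHL c d R S → S ⇒R Q → RHL c d P Q
  rDisj     : ∀ {c d Q R S} → RHL c d Q S → RHL c d R S → RHL c d (Q ∨R R) S
  rFalse    : ∀ {c d R} → RHL c d falseR R

{-# OPTIONS --safe #-}
-- RHL+ is complete for pairs of terminating executions: the strongest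
-- postcondition of one command is derivable against skip (a loop is aligned
-- with a loop that is never enabled, under the invariant "reachable by
-- iterating the body"), and c | c' follows from c ; skip | skip ; c' by
-- rewriting.  So it suffices that two terminating executions from S end in T.
-- A terminating execution of c is a run of aut(c,f) from lab c to f, and the
-- product can follow any two such runs while keeping the annotation: by the
-- covering condition an annotated state lies in L, R or J unless both sides
-- are final; since f has no successor, liveness shows that the sides that
-- have to move have not finished yet; and validity carries the annotation
-- along the move.
module Submission where

open import Defs
open import Data.Bool using (true; false; not)
import Data.Bool.Properties as BP
open import Data.Empty using (⊥-elim)
open import Data.Integer using (ℤ; +_; -_; _<_)
import Data.Integer.Properties as ℤP
open import Data.List using (List; []; _∷_; _++_)
open import Data.List.Membership.Propositional using (_∈_; _∉_)
open import Data.List.Membership.Propositional.Properties using (∈-++⁺ˡ; ∈-++⁺ʳ)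
open import Data.List.Relation.Binary.Disjoint.Propositional using (Disjoint)
open import Data.List.Relation.Unary.All as All using (All; _∷_)
import Data.List.Relation.Unary.All.Properties as AllP
open import Data.List.Relation.Unary.AllPairs using ([]; _∷_; head; tail)
open import Data.List.Relation.Unary.Any using (here; there)
open import Data.List.Relation.Unary.Unique.Propositional using (Unique)
open import Data.Product using (Σ; _×_; _,_; proj₁; proj₂)
open import Data.Sum using (_⊎_; inj₁; inj₂)
open import Data.Unit using (⊤; tt)
open import Relation.Binary.Construct.Closure.ReflexiveTransitive using (Star; ε; _◅_; _◅◅_)
open import Relation.Binary.PropositionalEquality using (_≡_; refl; sym; trans; cong)
open import Relation.Nullary using (¬_; does)
open import Relation.Nullary.Decidable using (dec-true; dec-false)

memb-∈ : ∀ {n ns} → n ∈ ns → memb n ns ≡ true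
memb-∈ {n} (here refl) rewrite dec-true (n ℤP.≟ n) refl = refl
memb-∈ {n} {m ∷ ms} (there n∈) rewrite memb-∈ n∈ = BP.∨-zeroʳ _

memb-∉ : ∀ {n} ns → n ∉ ns → memb n ns ≡ false
memb-∉ [] _ = refl
memb-∉ {n} (m ∷ ms) n∉ rewrite dec-false (n ℤP.≟ m) (λ n≡m → n∉ (here n≡m)) =
  memb-∉ ms (λ n∈ → n∉ (there n∈))

unique-++⁻ : ∀ {a} {A : Set a} (xs : List A) {ys} → Unique (xs ++ ys)
  → Unique xs × Unique ys × Disjoint xs ys
unique-++⁻ [] u = [] , u , λ ()
unique-++⁻ (x ∷ xs) (x∉ ∷ u) with unique-++⁻ xs u
... | uxs , uys , disjoint = AllP.++⁻ˡ xs x∉ ∷ uxs , uys , disjoint′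
  where
  disjoint′ : Disjoint (x ∷ xs) _
  disjoint′ (here refl , v∈ys) = All.lookup (AllP.++⁻ʳ xs x∉) v∈ys refl
  disjoint′ (there v∈xs , v∈ys) = disjoint (v∈xs , v∈ys)

ProperLabels : List ℤ → Set
ProperLabels ns = All (+ 0 <_) ns × Unique ns

proper-tail : ∀ {n ns} → ProperLabels (n ∷ ns) → ProperLabels ns
proper-tail (pos , u) = All.tail pos , tail u

proper-++⁻ : ∀ xs {ys} → ProperLabels (xs ++ ys)
  → ProperLabels xs × ProperLabels ys × Disjoint xs ys
proper-++⁻ xs (pos , u) with unique-++⁻ xs u
... | uxs , uys , disjoint = (AllP.++⁻ˡ xs pos , uxs) , (AllP.++⁻ʳ xs pos , uys) , disjoint

lab∈labs : ∀ c → lab c ∈ labs c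
lab∈labs (skip n) = here refl
lab∈labs (asgn n x e) = here refl
lab∈labs (havoc n x) = here refl
lab∈labs (c ⨾ d) = ∈-++⁺ˡ (lab∈labs c)
lab∈labs (ifc n g) = here refl
lab∈labs (doc n g) = here refl

branch-labs⊆ : ∀ {e c g n} → InG e c g → n ∈ labs c → n ∈ labsG g
branch-labs⊆ here1 n∈ = n∈
branch-labs⊆ hereC n∈ = ∈-++⁺ˡ n∈
branch-labs⊆ (there {c' = c'} i) n∈ = ∈-++⁺ʳ (labs c') (branch-labs⊆ i n∈)

branch-proper : ∀ {e c g} → InG e c g → ProperLabels (labsG g) → ProperLabels (labs c)
branch-proper here1 p = p
branch-proper {c = c} hereC p = proj₁ (proper-++⁻ (labs c) p)
branch-proper (there {c' = c'} i) p = branch-proper i (proj₁ (proj₂ (proper-++⁻ (labs c') p)))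

subC-trans : ∀ {a b c} → SubC a b → SubC b c → SubC a c
subC-trans refl q = q
subC-trans (seqL p) q = seqL (subC-trans p q)
subC-trans (seqR p) q = seqR (subC-trans p q)
subC-trans (inIf i p) q = inIf i (subC-trans p q)
subC-trans (inDo i p) q = inDo i (subC-trans p q)

subC-lab∈ : ∀ {c d} → SubC c d → lab d ∈ labs c
subC-lab∈ {c} refl = lab∈labs c
subC-lab∈ (seqL p) = ∈-++⁺ˡ (subC-lab∈ p)
subC-lab∈ {c ⨾ _} (seqR p) = ∈-++⁺ʳ (labs c) (subC-lab∈ p)
subC-lab∈ (inIf i p) = there (branch-labs⊆ i (subC-lab∈ p))
subC-lab∈ (inDo i p) = there (branch-labs⊆ i (subC-lab∈ p))

fsuc-⨾ˡ : ∀ {n c d k} → n ∈ labs c → fsuc n (c ⨾ d) k ≡ fsuc n c (lab d)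
fsuc-⨾ˡ n∈ rewrite memb-∈ n∈ = refl

fsuc-⨾ʳ : ∀ {n c d k} → n ∉ labs c → fsuc n (c ⨾ d) k ≡ fsuc n d k
fsuc-⨾ʳ {c = c} n∉ rewrite memb-∉ (labs c) n∉ = refl

fsucG-branch : ∀ {e d n k} g → InG e d g → Unique (labsG g) → n ∈ labs d
  → fsucG n g k ≡ fsuc n d k
fsucG-branch _ here1 _ _ = refl
fsucG-branch _ hereC _ n∈ rewrite memb-∈ n∈ = refl
fsucG-branch (_ ⇒ c ∷ g) (there i) u n∈ with unique-++⁻ (labs c) u
... | _ , ug , disjoint
  rewrite memb-∉ (labs c) (λ n∈c → disjoint (n∈c , branch-labs⊆ i n∈)) = fsucG-branch g i ug n∈

branch-label-fresh : ∀ {e d g n m} → Unique (m ∷ labsG g) → InG e d g → n ∈ labs d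
  → does (n ℤP.≟ m) ≡ false
branch-label-fresh u i n∈ =
  dec-false (_ ℤP.≟ _) (λ n≡m → All.lookup (head u) (branch-labs⊆ i n∈) (sym n≡m))

fsuc-ifc-branch : ∀ {e d g n m k} → Unique (m ∷ labsG g) → InG e d g → n ∈ labs d
  → fsuc n (ifc m g) k ≡ fsuc n d k
fsuc-ifc-branch {g = g} u i n∈ rewrite branch-label-fresh u i n∈ = fsucG-branch g i (tail u) n∈

fsuc-doc-branch : ∀ {e d g n m k} → Unique (m ∷ labsG g) → InG e d g → n ∈ labs d
  → fsuc n (doc m g) k ≡ fsuc n d m
fsuc-doc-branch {g = g} u i n∈ rewrite branch-label-fresh u i n∈ = fsucG-branch g i (tail u) n∈

fsuc-doc-self : ∀ {m g k} → fsuc m (doc m g) k ≡ k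
fsuc-doc-self {m} rewrite dec-true (m ℤP.≟ m) refl = refl

-- Terminating executions are runs of the automaton

data Exec : Cmd → Store → Store → Set where
  exSkip  : ∀ {n s} → Exec (skip n) s s
  exAsgn  : ∀ {n x e s} → Exec (asgn n x e) s (upd s x (evalI e s))
  exHavoc : ∀ {n x s} v → Exec (havoc n x) s (upd s x v)
  exSeq   : ∀ {c d s u t} → Exec c s u → Exec d u t → Exec (c ⨾ d) s t
  exIf    : ∀ {n g e c s t} → InG e c g → evalB e s ≡ true → Exec c s t → Exec (ifc n g) s t
  exLoop  : ∀ {n g e c s u t} → InG e c g → evalB e s ≡ true → Exec c s u
            → Exec (doc n g) u t → Exec (doc n g) s t
  exExit  : ∀ {n g s} → evalB (enab g) s ≡ false → Exec (doc n g) s s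

aut : Cmd → ℤ → ℤ × Store → ℤ × Store → Set
aut c f (n , s) (m , t) = AutStep c f n s m t

step-source : ∀ {c f n s m t} → AutStep c f n s m t → n ∈ labs c
step-source (inj₁ (_ , _ , (sc , _ , refl) , _)) = subC-lab∈ sc
step-source (inj₂ (inj₁ (_ , _ , (sc , _ , refl) , _))) = subC-lab∈ sc
step-source (inj₂ (inj₂ ((sc , _ , refl) , _))) = subC-lab∈ sc

final-stuck : ∀ {c f s} → f ∉ labs c → ¬ (Σ ℤ λ m → Σ Store λ t → AutStep c f f s m t)
final-stuck f∉ (_ , _ , st) = f∉ (step-source st)

run-ctrl : ∀ {c f n s t} → Star (aut c f) (n , s) (f , t) → Ctrl c f n
run-ctrl ε = inj₂ refl
run-ctrl (st ◅ _) = inj₁ (step-source st)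

-- Inside aut(c,f), the control points of the subcommand d behave as those of
-- aut(d,k): k is the control point reached when d has terminated.
record Placed (c : Cmd) (f : ℤ) (d : Cmd) (k : ℤ) : Set where
  field
    subcommand : SubC c d
    proper     : ProperLabels (labs d)
    fsuc≡      : ∀ n → n ∈ labs d → fsuc n c f ≡ fsuc n d k

open Placed

placed-root : ∀ {c f} → ProperLabels (labs c) → Placed c f c f
placed-root p = record { subcommand = refl ; proper = p ; fsuc≡ = λ _ _ → refl }

placed-⨾ˡ : ∀ {c f d₁ d₂ k} → Placed c f (d₁ ⨾ d₂) k → Placed c f d₁ (lab d₂)
placed-⨾ˡ {d₁ = d₁} {d₂} p = record
  { subcommand = subC-trans (subcommand p) (seqL refl)
  ; proper = proj₁ (proper-++⁻ (labs d₁) (proper p))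
  ; fsuc≡ = λ n n∈ → trans (fsuc≡ p n (∈-++⁺ˡ n∈)) (fsuc-⨾ˡ {c = d₁} {d = d₂} n∈)
  }

placed-⨾ʳ : ∀ {c f d₁ d₂ k} → Placed c f (d₁ ⨾ d₂) k → Placed c f d₂ k
placed-⨾ʳ {d₁ = d₁} {d₂} p with proper-++⁻ (labs d₁) (proper p)
... | _ , p₂ , disjoint = record
  { subcommand = subC-trans (subcommand p) (seqR refl)
  ; proper = p₂
  ; fsuc≡ = λ n n∈ → trans (fsuc≡ p n (∈-++⁺ʳ (labs d₁) n∈))
                           (fsuc-⨾ʳ {c = d₁} {d = d₂} (λ n∈d₁ → disjoint (n∈d₁ , n∈)))
  }

placed-ifc : ∀ {c f m g e d k} → Placed c f (ifc m g) k → InG e d g → Placed c f d k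
placed-ifc p i = record
  { subcommand = subC-trans (subcommand p) (inIf i refl)
  ; proper = branch-proper i (proper-tail (proper p))
  ; fsuc≡ = λ n n∈ → trans (fsuc≡ p n (there (branch-labs⊆ i n∈)))
                           (fsuc-ifc-branch (proj₂ (proper p)) i n∈)
  }

placed-doc : ∀ {c f m g e d k} → Placed c f (doc m g) k → InG e d g → Placed c f d m
placed-doc p i = record
  { subcommand = subC-trans (subcommand p) (inDo i refl)
  ; proper = branch-proper i (proper-tail (proper p))
  ; fsuc≡ = λ n n∈ → trans (fsuc≡ p n (there (branch-labs⊆ i n∈)))
                           (fsuc-doc-branch (proj₂ (proper p)) i n∈)
  }

module _ {c : Cmd} {f : ℤ} where

  lab-positive : ∀ {d k} → Placed c f d k → + 0 < lab d
  lab-positive {d} p = All.lookup (proj₁ (proper p)) (lab∈labs d)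

  entry-step : ∀ {d d' k s t} → Placed c f d k → NotSeq d → Step d s d' t → + 0 < lab d'
    → aut c f (lab d , s) (lab d' , t)
  entry-step p ns st pos = inj₁ (_ , _ , (subcommand p , ns , refl) , st , pos , refl)

  exit-step : ∀ {d n s t k} → Placed c f d k → NotSeq d → Step d s (skip (- n)) t → + 0 < n
    → fsuc (lab d) d k ≡ k → aut c f (lab d , s) (k , t)
  exit-step {d} p ns st pos fsuc≡k =
    inj₂ (inj₁ (_ , _ , (subcommand p , ns , refl) , st , ℤP.neg-mono-< pos ,
                sym (trans (fsuc≡ p (lab d) (lab∈labs d)) fsuc≡k)))

  skip-step : ∀ {n k s} → Placed c f (skip n) k → aut c f (n , s) (k , s)
  skip-step {n} p = inj₂ (inj₂ ((subcommand p , tt , refl) , sym (fsuc≡ p n (here refl)) , refl))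

  exec⇒run : ∀ {d k s t} → Placed c f d k → Exec d s t → Star (aut c f) (lab d , s) (k , t)
  exec⇒run p exSkip = skip-step p ◅ ε
  exec⇒run p exAsgn = exit-step p tt sAsgn (lab-positive p) refl ◅ ε
  exec⇒run p (exHavoc v) = exit-step p tt (sHavoc v) (lab-positive p) refl ◅ ε
  exec⇒run p (exSeq ex₁ ex₂) = exec⇒run (placed-⨾ˡ p) ex₁ ◅◅ exec⇒run (placed-⨾ʳ p) ex₂
  exec⇒run p (exIf i e-true ex) =
    entry-step p tt (sIf i e-true) (lab-positive (placed-ifc p i)) ◅ exec⇒run (placed-ifc p i) ex
  exec⇒run p (exLoop i e-true ex rest) =
    entry-step p tt (sDo i e-true) (lab-positive (placed-doc p i))
      ◅ (exec⇒run (placed-doc p i) ex ◅◅ exec⇒run p rest)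
  exec⇒run {doc m g} p (exExit disabled) =
    exit-step p tt (sDoExit disabled) (lab-positive p) (fsuc-doc-self {g = g}) ◅ ε

-- Soundness of a covering valid annotation

ValidAnnotation : Cmd → ℤ → Cmd → ℤ → PSet → PSet → PSet → (ℤ → ℤ → Rel) → Set
ValidAnnotation c f c' f' L R J an = ∀ n n' s s' m m' t t' → an n n' s s'
  → PStep c f c' f' L R J ((n , n') , (s , s')) ((m , m') , (t , t'))
  → an m m' t t'

Covering : Cmd → ℤ → Cmd → ℤ → PSet → PSet → PSet → (ℤ → ℤ → Rel) → Set
Covering c f c' f' L R J an = ∀ i j → Ctrl c f i → Ctrl c' f' j → ∀ s s' → an i j s s'
  → L ((i , j) , (s , s')) ⊎ R ((i , j) , (s , s')) ⊎ J ((i , j) , (s , s'))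
    ⊎ (i ≡ f × j ≡ f')

module _ {c c' : Cmd} {f f' : ℤ} {L R J : PSet} {an : ℤ → ℤ → Rel}
         (f∉c : f ∉ labs c) (f'∉c' : f' ∉ labs c')
         (live : Live c f c' f' L R J)
         (valid : ValidAnnotation c f c' f' L R J an)
         (covering : Covering c f c' f' L R J an) where

  annotation-sound : ∀ {n n' s s' t t'}
    → Star (aut c f) (n , s) (f , t) → Star (aut c' f') (n' , s') (f' , t')
    → an n n' s s' → an f f' t t'
  annotation-sound {n} {n'} {s} {s'} r r' a with covering n n' (run-ctrl r) (run-ctrl r') s s' a
  annotation-sound (st ◅ r) r' a | inj₁ inL =
    annotation-sound r r' (valid _ _ _ _ _ _ _ _ a (inj₁ (inL , st , refl , refl)))
  annotation-sound ε r' a | inj₁ inL = ⊥-elim (final-stuck f∉c (proj₁ live _ _ _ _ inL))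
  annotation-sound r (st' ◅ r') a | inj₂ (inj₁ inR) =
    annotation-sound r r' (valid _ _ _ _ _ _ _ _ a (inj₂ (inj₁ (inR , refl , refl , st'))))
  annotation-sound r ε a | inj₂ (inj₁ inR) =
    ⊥-elim (final-stuck f'∉c' (proj₁ (proj₂ live) _ _ _ _ inR))
  annotation-sound (st ◅ r) (st' ◅ r') a | inj₂ (inj₂ (inj₁ inJ)) =
    annotation-sound r r' (valid _ _ _ _ _ _ _ _ a (inj₂ (inj₂ (inJ , st , st'))))
  annotation-sound ε _ a | inj₂ (inj₂ (inj₁ inJ)) =
    ⊥-elim (final-stuck f∉c (proj₁ (proj₂ (proj₂ live) _ _ _ _ inJ)))
  annotation-sound (_ ◅ _) ε a | inj₂ (inj₂ (inj₁ inJ)) =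
    ⊥-elim (final-stuck f'∉c' (proj₂ (proj₂ (proj₂ live) _ _ _ _ inJ)))
  annotation-sound ε ε a | inj₂ (inj₂ (inj₂ _)) = a
  annotation-sound (st ◅ _) _ a | inj₂ (inj₂ (inj₂ (refl , _))) = ⊥-elim (f∉c (step-source st))
  annotation-sound ε (st' ◅ _) a | inj₂ (inj₂ (inj₂ (_ , refl))) = ⊥-elim (f'∉c' (step-source st'))

trueB falseB : BExp
trueB = prim (eqP (lit (+ 0)) (lit (+ 0)))
falseB = notB trueB

trueB-valid : ValidB trueB
trueB-valid _ = refl

valid⇒≈𝟙 : ∀ {e} → ValidB e → KEq (tst ⌊ e ⌋B) 𝟙
valid⇒≈𝟙 {e} e-valid =
  ktrans (ksym ⊕zero)
    (ktrans (k⊕cong krefl (ksym (hypUnsat {notB e} (λ s → cong not (e-valid s))))) tcomplJ)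

unsat⇒¬≈𝟙 : ∀ {e} → (∀ s → evalB e s ≡ false) → KEq (tst (tnot ⌊ e ⌋B)) 𝟙
unsat⇒¬≈𝟙 e-unsat =
  ktrans (ksym ⊕zero) (ktrans ⊕comm (ktrans (k⊕cong (ksym (hypUnsat e-unsat)) krefl) tcomplJ))

𝟘⋆≈𝟙 : KEq (𝟘 ⋆) 𝟙
𝟘⋆≈𝟙 = ktrans (ksym unfoldˡ) (ktrans (k⊕cong krefl ⊙zeroˡ) ⊕zero)

trivial-ifc≃skip : ∀ {m e k} → ValidB e → ifc m [ e ⇒ skip k ] ≃ skip k
trivial-ifc≃skip e-valid = ktrans ⊙oneʳ (valid⇒≈𝟙 e-valid)

trivial-doc≃skip : ∀ {m e k} → (∀ s → evalB e s ≡ false) → doc m [ e ⇒ skip k ] ≃ skip k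
trivial-doc≃skip e-unsat =
  ktrans (k⊙cong (ktrans (k⋆cong (ktrans ⊙oneʳ (hypUnsat e-unsat))) 𝟘⋆≈𝟙)
                 (unsat⇒¬≈𝟙 e-unsat))
         ⊙oneˡ

-- Completeness of RHL+ for terminating executions

rPre : ∀ {c d P P' Q} → P ⇒R P' → RHL c d P' Q → RHL c d P Q
rPre P⇒P' j = rConseq P⇒P' j (λ _ _ q → q)

rPost : ∀ {c d P Q Q'} → RHL c d P Q → Q ⇒R Q' → RHL c d P Q'
rPost j Q⇒Q' = rConseq (λ _ _ p → p) j Q⇒Q'

rVacuous : ∀ {c d P Q} → (∀ s s' → ¬ P s s') → RHL c d P Q
rVacuous ¬P = rPre ¬P rFalse

Postˡ Postʳ : Cmd → Rel → Rel
Postˡ c P t s' = Σ Store λ s → P s s' × Exec c s t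
Postʳ c P s t' = Σ Store λ s' → P s s' × Exec c s' t'

-- u is reached from s by iterating the loop body, phrased as: every
-- execution of the loop from u is the tail of one from s.
LoopInvˡ LoopInvʳ : ℤ → GCs → Rel → Rel
LoopInvˡ n g P u s' = Σ Store λ s → P s s' × (∀ {t} → Exec (doc n g) u t → Exec (doc n g) s t)
LoopInvʳ n g P s u' = Σ Store λ s' → P s s' × (∀ {t} → Exec (doc n g) u' t → Exec (doc n g) s' t)

mutual
  spˡ : ∀ c → WF c → ∀ k P → RHL c (skip k) P (Postˡ c P)
  spˡ (skip n) _ k P = rPost rSkip (λ t s' p → t , p , exSkip)
  spˡ (asgn n x e) _ k P = rPre (λ s s' p → s , p , exAsgn) rAsgnSkip
  spˡ (havoc n x) _ k P = rPre (λ s s' p v → s , p , exHavoc v) rHavSkip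
  spˡ (c ⨾ d) (wc , wd) k P =
    rRewrite (rSeq (spˡ c wc k P) (rPost (spˡ d wd k (Postˡ c P)) compose))
      (wc , wd) (tt , tt) krefl ⊙oneˡ
    where
    compose : Postˡ d (Postˡ c P) ⇒R Postˡ (c ⨾ d) P
    compose t s' (_ , (s , p , ex₁) , ex₂) = s , p , exSeq ex₁ ex₂
  spˡ (ifc n g) (g-total , wg) k P =
    rRewrite {c = ifc n g} {c' = ifc (+ 0) [ trueB ⇒ skip k ]}
      (rIf λ { _ _ _ _ i here1 →
        rPost (spˡ-branch g wg i k _) (λ t s' (s , (p , e-true , _) , ex) → s , p , exIf i e-true ex) })
      (g-total , wg) (trueB-valid , tt) krefl (trivial-ifc≃skip {+ 0} {trueB} {k} trueB-valid)
  spˡ (doc n g) wg k P =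
    rRewrite {c = doc n g} {c' = doc (+ 0) [ falseB ⇒ skip k ]}
      (rPre (λ s s' p → s , p , λ {_} ex → ex)
        (rPost (rDo {k = k} {k' = k} (LoopInvˡ n g P) (λ _ _ → ⊤) falseR
                  iteration
                  (λ { _ _ here1 → rVacuous λ { _ _ (_ , () , _) } })
                  (λ { _ _ _ _ _ here1 → rVacuous λ { _ _ (_ , _ , () , _) } })
                  (λ s s' _ → enabled-or-done s s'))
               exit))
      wg tt krefl (trivial-doc≃skip {+ 0} {falseB} {k} (λ _ → refl))
    where
    iteration : ∀ e c → InG e c g
      → RHL c (skip k) (LoopInvˡ n g P ∧R ⟨ e ] ∧R (λ _ _ → ⊤)) (LoopInvˡ n g P)
    iteration _ _ i = rPost (spˡ-branch g wg i k _)
      λ t s' (u , ((s , p , extend) , e-true , _) , ex) →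
        s , p , λ {_} rest → extend (exLoop i e-true ex rest)
    enabled-or-done : ∀ s s' → (⟨ enab g ∣=∣ falseB ⟩ ∨R ((λ _ _ → ⊤) ∧R ⟨ enab g ])
                                   ∨R (falseR ∧R [ falseB ⟩)) s s'
    enabled-or-done s _ with evalB (enab g) s
    ... | false = inj₁ refl
    ... | true = inj₂ (inj₁ (tt , refl))
    exit : (LoopInvˡ n g P ∧R ¬R ⟨ enab g ] ∧R ¬R [ falseB ⟩) ⇒R Postˡ (doc n g) P
    exit t s' ((s , p , extend) , disabled , _) = s , p , extend (exExit (BP.¬-not disabled))

  spˡ-branch : ∀ g → WFG g → ∀ {e c} → InG e c g → ∀ k P → RHL c (skip k) P (Postˡ c P)
  spˡ-branch [ _ ⇒ c ] w here1 = spˡ c w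
  spˡ-branch (_ ⇒ c ∷ _) (w , _) hereC = spˡ c w
  spˡ-branch (_ ⇒ _ ∷ g) (_ , w) (there i) = spˡ-branch g w i

mutual
  spʳ : ∀ c → WF c → ∀ k P → RHL (skip k) c P (Postʳ c P)
  spʳ (skip n) _ k P = rPost rSkip (λ s t p → t , p , exSkip)
  spʳ (asgn n x e) _ k P = rPre (λ s s' p → s' , p , exAsgn) rSkipAsgn
  spʳ (havoc n x) _ k P = rPre (λ s s' p v → s' , p , exHavoc v) rSkipHav
  spʳ (c ⨾ d) (wc , wd) k P =
    rRewrite (rSeq (spʳ c wc k P) (rPost (spʳ d wd k (Postʳ c P)) compose))
      (tt , tt) (wc , wd) ⊙oneˡ krefl
    where
    compose : Postʳ d (Postʳ c P) ⇒R Postʳ (c ⨾ d) P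
    compose s t (_ , (s' , p , ex₁) , ex₂) = s' , p , exSeq ex₁ ex₂
  spʳ (ifc n g) (g-total , wg) k P =
    rRewrite {c = ifc (+ 0) [ trueB ⇒ skip k ]} {c' = ifc n g}
      (rIf λ { _ _ _ _ here1 i →
        rPost (spʳ-branch g wg i k _) (λ s t (s' , (p , _ , e-true) , ex) → s' , p , exIf i e-true ex) })
      (trueB-valid , tt) (g-total , wg) (trivial-ifc≃skip {+ 0} {trueB} {k} trueB-valid) krefl
  spʳ (doc n g) wg k P =
    rRewrite {c = doc (+ 0) [ falseB ⇒ skip k ]} {c' = doc n g}
      (rPre (λ s s' p → s' , p , λ {_} ex → ex)
        (rPost (rDo {k = k} {k' = k} (LoopInvʳ n g P) falseR (λ _ _ → ⊤)
                  (λ { _ _ here1 → rVacuous λ { _ _ (_ , () , _) } })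
                  iteration
                  (λ { _ _ _ _ here1 _ → rVacuous λ { _ _ (_ , () , _) } })
                  (λ s s' _ → enabled-or-done s s'))
               exit))
      tt wg (trivial-doc≃skip {+ 0} {falseB} {k} (λ _ → refl)) krefl
    where
    iteration : ∀ e c → InG e c g
      → RHL (skip k) c (LoopInvʳ n g P ∧R [ e ⟩ ∧R (λ _ _ → ⊤)) (LoopInvʳ n g P)
    iteration _ _ i = rPost (spʳ-branch g wg i k _)
      λ s t (u , ((s' , p , extend) , e-true , _) , ex) →
        s' , p , λ {_} rest → extend (exLoop i e-true ex rest)
    enabled-or-done : ∀ s s' → (⟨ falseB ∣=∣ enab g ⟩ ∨R (falseR ∧R ⟨ falseB ])
                                 ∨R ((λ _ _ → ⊤) ∧R [ enab g ⟩)) s s'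
    enabled-or-done _ s' with evalB (enab g) s'
    ... | false = inj₁ refl
    ... | true = inj₂ (inj₂ (tt , refl))
    exit : (LoopInvʳ n g P ∧R ¬R ⟨ falseB ] ∧R ¬R [ enab g ⟩) ⇒R Postʳ (doc n g) P
    exit s t ((s' , p , extend) , _ , disabled) = s' , p , extend (exExit (BP.¬-not disabled))

  spʳ-branch : ∀ g → WFG g → ∀ {e c} → InG e c g → ∀ k P → RHL (skip k) c P (Postʳ c P)
  spʳ-branch [ _ ⇒ c ] w here1 = spʳ c w
  spʳ-branch (_ ⇒ c ∷ _) (w , _) hereC = spʳ c w
  spʳ-branch (_ ⇒ _ ∷ g) (_ , w) (there i) = spʳ-branch g w i

rhl-complete : ∀ {c c' S T} → WF c → WF c'
  → (∀ {s s' t t'} → S s s' → Exec c s t → Exec c' s' t' → T t t')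
  → RHL c c' S T
rhl-complete {c} {c'} {S} {T} wc wc' S⇒T =
  rRewrite (rSeq (spˡ c wc (+ 0) S) (rPost (spʳ c' wc' (+ 0) (Postˡ c S)) final))
    (wc , tt) (tt , wc') ⊙oneʳ ⊙oneˡ
  where
  final : Postʳ c' (Postˡ c S) ⇒R T
  final t t' (s' , (s , Sss' , ex) , ex') = S⇒T Sss' ex ex'

theorem6p1 : (c c' : Cmd) (f f' : ℤ) → WF c → WF c' → okf c f → okf c' f'
  → (L R J : PSet)
  → InCtrl c f c' f' L → InCtrl c f c' f' R → InCtrl c f c' f' J
  → Live c f c' f' L R J
  → (S T : Rel) (an : ℤ → ℤ → Rel)
  → an (lab c) (lab c') ≐ S
  → an f f' ≐ T
  → (∀ n n' s s' m m' t t' → an n n' s s'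
      → PStep c f c' f' L R J ((n , n') , (s , s')) ((m , m') , (t , t'))
      → an m m' t t')
  → (∀ i j → Ctrl c f i → Ctrl c' f' j → ∀ s s' → an i j s s'
      → L ((i , j) , (s , s')) ⊎ R ((i , j) , (s , s')) ⊎ J ((i , j) , (s , s'))
        ⊎ (i ≡ f × j ≡ f'))
  → RHL c c' S T
theorem6p1 c c' f f' wc wc' (pos , uniq , f∉c) (pos' , uniq' , f'∉c') L R J _ _ _ live S T an
  (_ , S⇒an) (an⇒T , _) valid covering =
  rhl-complete wc wc' λ {s} {s'} {t} {t'} Sss' ex ex' →
    an⇒T t t' (annotation-sound f∉c f'∉c' live valid covering
                 (exec⇒run (placed-root (pos , uniq)) ex)
                 (exec⇒run (placed-root (pos' , uniq')) ex')
                 (S⇒an s s' Sss'))
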